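{- Let $G$ be a minimal counterexample (as defined in the context). Let $uvwx$ be a $2$-path in $G$ (so $v,w$ have degree $2$). If $d(u)=7$ and $d(x)\leq 6$, then $u$ is not adjacent to $x$.
   Context: A $2$-distance $k$-coloring of a graph assigns colors from $\{1,\dots,k\}$ so that distinct vertices at distance at most $2$ get different colors. A minimal counterexample is a finite simple graph $G$ with $\mathrm{mad}(G)\leq 18/7$ (equivalently $9|A|-7|E(G[A])|\geq 0$ for all $A\subseteq V(G)$), maximum degree $\Delta(G)=7$, that has no $2$-distance $8$-coloring, and such that every graph $H$ with $\mathrm{mad}(H)\leq 18/7$, maximum degree at most $7$ and $|V(H)|+|E(H)|<|V(G)|+|E(G)|$ has a $2$-distance $8$-coloring. A $k$-path is a path of length $k+1$ whose $k$ internal vertices have degree $2$ in $G$. -}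

module Defs where

open import Data.Nat using (ℕ; zero; suc; _+_; _*_; _≤_; _<_; _<?_)
open import Data.Fin using (Fin; toℕ)
import Data.Fin as F
open import Data.Bool using (Bool; true; false; _∧_; if_then_else_)
open import Data.Product using (Σ; _×_; ∃; ∃-syntax)
open import Data.Sum using (_⊎_)
open import Relation.Binary.PropositionalEquality using (_≡_; _≢_)
open import Relation.Nullary using (¬_; does)

sumFin : ∀ {n} → (Fin n → ℕ) → ℕ
sumFin {zero} f = 0
sumFin {suc n} f = f F.zero + sumFin (λ i → f (F.suc i))

count : ∀ {n} → (Fin n → Bool) → ℕ
count p = sumFin (λ i → if p i then 1 else 0)

record Graph : Set where
  field
    n          : ℕ
    adj        : Fin n → Fin n → Bool
    adj-sym    : ∀ i j → adj i j ≡ adj j i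
    adj-irrefl : ∀ i → adj i i ≡ false

open Graph public

Vertex : Graph → Set
Vertex G = Fin (n G)

Adj : (G : Graph) → Vertex G → Vertex G → Set
Adj G u v = adj G u v ≡ true

deg : (G : Graph) → Vertex G → ℕ
deg G v = count (adj G v)

Subset : Graph → Set
Subset G = Vertex G → Bool

card : (G : Graph) → Subset G → ℕ
card G A = count A

-- |E(G[A])|: edges ij (counted once, via toℕ j < toℕ i) with both ends in A
edgesIn : (G : Graph) → Subset G → ℕ
edgesIn G A = sumFin (λ i → count (λ j → A i ∧ A j ∧ does (toℕ j <? toℕ i) ∧ adj G i j))

nVert : Graph → ℕ
nVert G = n G

nEdges : Graph → ℕ
nEdges G = edgesIn G (λ _ → true)

-- mad(G) ≤ 18/7, stated as: 9|A| - 7|E(G[A])| ≥ 0 for all A ⊆ V(G)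
MadLe18/7 : Graph → Set
MadLe18/7 G = ∀ (A : Subset G) → 7 * edgesIn G A ≤ 9 * card G A

MaxDegLe : Graph → ℕ → Set
MaxDegLe G D = ∀ v → deg G v ≤ D

MaxDegEq : Graph → ℕ → Set
MaxDegEq G D = MaxDegLe G D × ∃[ v ] deg G v ≡ D

Dist≤2 : (G : Graph) → Vertex G → Vertex G → Set
Dist≤2 G u v = Adj G u v ⊎ (∃[ w ] (Adj G u w × Adj G w v))

Is2DistColoring : (G : Graph) (k : ℕ) → (Vertex G → Fin k) → Set
Is2DistColoring G k c = ∀ u v → u ≢ v → Dist≤2 G u v → c u ≢ c v

Has2DistColoring : Graph → ℕ → Set
Has2DistColoring G k = ∃[ c ] Is2DistColoring G k c

MinimalCounterexample : Graph → Set
MinimalCounterexample G =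
  MadLe18/7 G × MaxDegEq G 7 × ¬ Has2DistColoring G 8 ×
  (∀ (H : Graph) → MadLe18/7 H → MaxDegLe H 7 →
     nVert H + nEdges H < nVert G + nEdges G → Has2DistColoring H 8)

Is2Path : (G : Graph) → Vertex G → Vertex G → Vertex G → Vertex G → Set
Is2Path G u v w x =
  u ≢ v × u ≢ w × u ≢ x × v ≢ w × v ≢ x × w ≢ x ×
  Adj G u v × Adj G v w × Adj G w x ×
  deg G v ≡ 2 × deg G w ≡ 2

-- Delete the two edges at the middle vertex w of the 2-path. The smaller graph still has
-- mad ≤ 18/7 and Δ ≤ 7, so by minimality it has a 2-distance colouring; this colouring stays
-- valid in G away from w, because v and x, no longer joined through w, are still joined
-- through u. In G the vertices within distance 2 of w are v, x and the neighbours of x other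
-- than w, among them u; so at most 2 + (d(x) − 1) ≤ 7 colours are forbidden at w and w can be
-- recoloured, contradicting that G has no 2-distance 8-colouring.
module Submission where

open import Defs
open import Data.Nat using (ℕ; zero; suc; _+_; _≤_; _<_; _<?_; z≤n; s≤s)
open import Data.Nat.Properties
  using (≤-refl; ≤-trans; ≤-<-trans; <⇒≱; <-cmp; +-suc; +-mono-≤; +-mono-<-≤; +-mono-≤-<; +-monoʳ-<; *-monoʳ-≤)
open import Data.Fin as Fin using (Fin; toℕ; _≟_)
open import Data.Fin.Properties using (any?; injective⇒≤; toℕ-injective)
open import Data.Bool using (Bool; true; false; _∧_; not; if_then_else_)
open import Data.Bool.Properties using (∧-comm; ∧-zeroʳ)
open import Data.List using (List; []; _∷_; length; lookup)
open import Data.List.Relation.Unary.Any using (here; there; index)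
open import Data.List.Relation.Unary.Any.Properties using (lookup-index)
open import Data.List.Membership.Propositional using (_∈_; _∉_)
import Data.List.Membership.DecPropositional as DecMembership
open import Data.Product using (_,_; ∃-syntax; proj₁; proj₂)
open import Data.Sum using (_⊎_; inj₁; inj₂; map₂)
open import Data.Empty using (⊥-elim)
open import Function using (_∘_; case_of_)
open import Relation.Binary.Definitions using (tri<; tri≈; tri>)
open import Relation.Binary.PropositionalEquality using (_≡_; _≢_; refl; sym; trans; cong; cong₂; subst)
open import Relation.Nullary using (¬_; does; yes; no; ¬?)
open import Relation.Nullary.Decidable using (dec-true; dec-false; decidable-stable)

∧-true⇒ʳ : ∀ a {b} → a ∧ b ≡ true → b ≡ true
∧-true⇒ʳ true ab = ab

∧-monoʳ : ∀ a {b c} → (b ≡ true → c ≡ true) → a ∧ b ≡ true → a ∧ c ≡ true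
∧-monoʳ true b⇒c = b⇒c

sumFin-mono : ∀ {n} {f g : Fin n → ℕ} → (∀ i → f i ≤ g i) → sumFin f ≤ sumFin g
sumFin-mono {zero} f≤g = z≤n
sumFin-mono {suc n} f≤g = +-mono-≤ (f≤g Fin.zero) (sumFin-mono (f≤g ∘ Fin.suc))

sumFin-mono-< : ∀ {n} {f g : Fin n → ℕ} → (∀ i → f i ≤ g i) → ∀ k → f k < g k → sumFin f < sumFin g
sumFin-mono-< f≤g Fin.zero    fk<gk = +-mono-<-≤ fk<gk (sumFin-mono (f≤g ∘ Fin.suc))
sumFin-mono-< f≤g (Fin.suc k) fk<gk = +-mono-≤-< (f≤g Fin.zero) (sumFin-mono-< (f≤g ∘ Fin.suc) k fk<gk)

_⊆ᵇ_ : ∀ {n} → (Fin n → Bool) → (Fin n → Bool) → Set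
p ⊆ᵇ q = ∀ i → p i ≡ true → q i ≡ true

indicator-mono : ∀ {a b : Bool} → (a ≡ true → b ≡ true) → (if a then 1 else 0) ≤ (if b then 1 else 0)
indicator-mono {true} a⇒b rewrite a⇒b refl = ≤-refl
indicator-mono {false}  _   = z≤n

count-mono : ∀ {n} {p q : Fin n → Bool} → p ⊆ᵇ q → count p ≤ count q
count-mono p⊆q = sumFin-mono (indicator-mono ∘ p⊆q)

count-mono-< : ∀ {n} {p q : Fin n → Bool} → p ⊆ᵇ q → ∀ k → p k ≡ false → q k ≡ true → count p < count q
count-mono-< {p = p} {q} p⊆q k pk qk = sumFin-mono-< (indicator-mono ∘ p⊆q) k gap
  where
  gap : (if p k then 1 else 0) < (if q k then 1 else 0)
  gap rewrite pk | qk = s≤s z≤n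

remove : ∀ {n} → (Fin n → Bool) → Fin n → Fin n → Bool
remove p a i = not (does (i ≟ a)) ∧ p i

count-remove : ∀ {n} (p : Fin n → Bool) {a} → p a ≡ true → count p ≡ suc (count (remove p a))
count-remove p {Fin.zero}  pa rewrite pa = refl
count-remove p {Fin.suc a} pa =
  trans (cong ((if p Fin.zero then 1 else 0) +_) (count-remove (p ∘ Fin.suc) pa)) (+-suc _ _)

remove-true : ∀ {n} (p : Fin n → Bool) {a i} → i ≢ a → p i ≡ true → remove p a i ≡ true
remove-true p {a} {i} i≢a pi rewrite dec-false (i ≟ a) i≢a = pi

colours : ∀ {n k} → (Fin n → Fin k) → (Fin n → Bool) → List (Fin k)
colours {zero}  c p = []
colours {suc n} c p with p Fin.zero
... | true  = c Fin.zero ∷ colours (c ∘ Fin.suc) (p ∘ Fin.suc)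
... | false = colours (c ∘ Fin.suc) (p ∘ Fin.suc)

length-colours : ∀ {n k} (c : Fin n → Fin k) p → length (colours c p) ≡ count p
length-colours {zero}  c p = refl
length-colours {suc n} c p with p Fin.zero
... | true  = cong suc (length-colours (c ∘ Fin.suc) (p ∘ Fin.suc))
... | false = length-colours (c ∘ Fin.suc) (p ∘ Fin.suc)

∈-colours : ∀ {n k} (c : Fin n → Fin k) p {i} → p i ≡ true → c i ∈ colours c p
∈-colours {suc n} c p {Fin.zero} pi with p Fin.zero
∈-colours {suc n} c p {Fin.zero} refl | true = here refl
∈-colours {suc n} c p {Fin.suc i} pi with p Fin.zero
... | true  = there (∈-colours (c ∘ Fin.suc) (p ∘ Fin.suc) pi)
... | false = ∈-colours (c ∘ Fin.suc) (p ∘ Fin.suc) pi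

short-list-misses : ∀ {m} (L : List (Fin m)) → length L < m → ∃[ k ] k ∉ L
short-list-misses {m} L short with any? (λ k → ¬? (DecMembership._∈?_ _≟_ k L))
... | yes missing = missing
... | no  ¬missing = ⊥-elim (<⇒≱ short (injective⇒≤ index-injective))
  where
  everywhere : ∀ k → k ∈ L
  everywhere k = decidable-stable (DecMembership._∈?_ _≟_ k L) (λ k∉L → ¬missing (k , k∉L))

  index-injective : ∀ {i j} → index (everywhere i) ≡ index (everywhere j) → i ≡ j
  index-injective {i} {j} e =
    trans (lookup-index (everywhere i)) (trans (cong (lookup L) e) (sym (lookup-index (everywhere j))))

Adj-sym : (G : Graph) {a b : Vertex G} → Adj G a b → Adj G b a
Adj-sym G {a} {b} ab = trans (adj-sym G b a) ab

Dist≤2-sym : (G : Graph) {a b : Vertex G} → Dist≤2 G a b → Dist≤2 G b a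
Dist≤2-sym G (inj₁ ab)           = inj₁ (Adj-sym G ab)
Dist≤2-sym G (inj₂ (m , am , mb)) = inj₂ (m , Adj-sym G mb , Adj-sym G am)

neighbours-of-degree-2 : (G : Graph) {z a b t : Vertex G} → deg G z ≡ 2 →
  Adj G z a → Adj G z b → a ≢ b → Adj G z t → t ≡ a ⊎ t ≡ b
neighbours-of-degree-2 G {z} {a} {b} {t} dz za zb a≢b zt with t ≟ a | t ≟ b
... | yes t≡a | _       = inj₁ t≡a
... | no _    | yes t≡b = inj₂ t≡b
... | no t≢a  | no t≢b  = case trans (sym dz) three-neighbours of λ ()
  where
  three-neighbours : deg G z ≡ 3 + count (remove (remove (remove (adj G z) a) b) t)
  three-neighbours =
    trans (count-remove (adj G z) za) (cong suc
    (trans (count-remove (remove (adj G z) a) {b} (remove-true (adj G z) (a≢b ∘ sym) zb)) (cong suc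
    (count-remove (remove (remove (adj G z) a) b) {t}
      (remove-true (remove (adj G z) a) t≢b (remove-true (adj G z) t≢a zt))))))

recolour : (G : Graph) {k : ℕ} (w : Vertex G) (c : Vertex G → Fin k) (col : Fin k) →
  (∀ s t → s ≢ t → s ≢ w → t ≢ w → Dist≤2 G s t → c s ≢ c t) →
  (∀ t → t ≢ w → Dist≤2 G w t → col ≢ c t) →
  Has2DistColoring G k
recolour G {k} w c col proper-away col-free = c′ , proper
  where
  c′ : Vertex G → Fin k
  c′ s = if does (s ≟ w) then col else c s

  proper : Is2DistColoring G k c′
  proper s t s≢t d with s ≟ w | t ≟ w
  ... | yes refl | yes refl = ⊥-elim (s≢t refl)
  ... | yes refl | no t≢w  = col-free t t≢w d
  ... | no s≢w  | yes refl = col-free s s≢w (Dist≤2-sym G d) ∘ sym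
  ... | no s≢w  | no t≢w  = proper-away s t s≢t s≢w t≢w d

module Isolate (G : Graph) (w : Vertex G) where

  kept : Vertex G → Vertex G → Bool
  kept i j = not (does (i ≟ w)) ∧ not (does (j ≟ w))

  isolated : Graph
  isolated = record
    { n          = n G
    ; adj        = λ i j → kept i j ∧ adj G i j
    ; adj-sym    = λ i j → cong₂ _∧_ (∧-comm (not (does (i ≟ w))) _) (adj-sym G i j)
    ; adj-irrefl = λ i → trans (cong (kept i i ∧_) (adj-irrefl G i)) (∧-zeroʳ _)
    }

  Adj⇒Adj-isolated : ∀ {s t} → s ≢ w → t ≢ w → Adj G s t → Adj isolated s t
  Adj⇒Adj-isolated {s} {t} s≢w t≢w st rewrite dec-false (s ≟ w) s≢w | dec-false (t ≟ w) t≢w = st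

  adj-isolated-⊆ : ∀ i → adj isolated i ⊆ᵇ adj G i
  adj-isolated-⊆ i j = ∧-true⇒ʳ (kept i j)

  w-isolatedˡ : ∀ j → adj isolated w j ≡ false
  w-isolatedˡ j rewrite dec-true (w ≟ w) refl = refl

  w-isolatedʳ : ∀ i → adj isolated i w ≡ false
  w-isolatedʳ i rewrite dec-true (w ≟ w) refl | ∧-zeroʳ (not (does (i ≟ w))) = refl

  deg-isolated-< : ∀ {z} → Adj G z w → deg isolated z < deg G z
  deg-isolated-< {z} zw = count-mono-< (adj-isolated-⊆ z) w (w-isolatedʳ z) zw

  isolated-mad : MadLe18/7 G → MadLe18/7 isolated
  isolated-mad mad A = ≤-trans (*-monoʳ-≤ 7 fewer) (mad A)
    where
    fewer : edgesIn isolated A ≤ edgesIn G A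
    fewer = sumFin-mono λ i → count-mono λ j →
      ∧-monoʳ (A i) (∧-monoʳ (A j) (∧-monoʳ _ (adj-isolated-⊆ i j)))

  isolated-maxdeg : ∀ {D} → MaxDegLe G D → MaxDegLe isolated D
  isolated-maxdeg Δ≤D z = ≤-trans (count-mono (adj-isolated-⊆ z)) (Δ≤D z)

  lost-edge⇒nEdges-< : ∀ {i j} → toℕ j < toℕ i → Adj G i j → adj isolated i j ≡ false →
    nEdges isolated < nEdges G
  lost-edge⇒nEdges-< {i} {j} j<i ij lost =
    sumFin-mono-< (λ i′ → count-mono λ j′ → ∧-monoʳ _ (adj-isolated-⊆ i′ j′)) i
      (count-mono-< (λ j′ → ∧-monoʳ _ (adj-isolated-⊆ i j′)) j dropped present)
    where
    dropped : does (toℕ j <? toℕ i) ∧ adj isolated i j ≡ false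
    dropped rewrite lost = ∧-zeroʳ _
    present : does (toℕ j <? toℕ i) ∧ adj G i j ≡ true
    present rewrite dec-true (toℕ j <? toℕ i) j<i = ij

  nEdges-isolated-< : ∀ {v} → Adj G w v → nEdges isolated < nEdges G
  nEdges-isolated-< {v} wv with <-cmp (toℕ v) (toℕ w)
  ... | tri< v<w _ _ = lost-edge⇒nEdges-< v<w wv (w-isolatedˡ v)
  ... | tri≈ _ v≡w _ = case trans (sym (adj-irrefl G w)) (subst (Adj G w) (toℕ-injective v≡w) wv) of λ ()
  ... | tri> _ _ w<v = lost-edge⇒nEdges-< w<v (Adj-sym G wv) (w-isolatedʳ v)

open Isolate

2-path-ends-joined : (G : Graph) {u v w x : Vertex G} → Is2Path G u v w x → Adj G u x →
  Dist≤2 (isolated G w) v x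
2-path-ends-joined G (_ , u≢w , _ , v≢w , _ , w≢x , uv , _) ux =
  inj₂ (_ , Adj⇒Adj-isolated G _ v≢w u≢w (Adj-sym G uv) , Adj⇒Adj-isolated G _ u≢w (w≢x ∘ sym) ux)

Dist≤2-isolated : (G : Graph) {u v w x : Vertex G} → Is2Path G u v w x → Adj G u x →
  ∀ s t → s ≢ t → s ≢ w → t ≢ w → Dist≤2 G s t → Dist≤2 (isolated G w) s t
Dist≤2-isolated G _ _ s t _ s≢w t≢w (inj₁ st) = inj₁ (Adj⇒Adj-isolated G _ s≢w t≢w st)
Dist≤2-isolated G {w = w} path@(_ , _ , _ , _ , v≢x , _ , _ , vw , wx , _ , dw) ux s t s≢t s≢w t≢w
  (inj₂ (m , sm , mt)) with m ≟ w
... | no m≢w = inj₂ (m , Adj⇒Adj-isolated G _ s≢w m≢w sm , Adj⇒Adj-isolated G _ m≢w t≢w mt)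
... | yes refl with neighbours-of-degree-2 G dw (Adj-sym G vw) wx v≢x (Adj-sym G sm)
                  | neighbours-of-degree-2 G dw (Adj-sym G vw) wx v≢x mt
... | inj₁ refl | inj₁ refl = ⊥-elim (s≢t refl)
... | inj₁ refl | inj₂ refl = 2-path-ends-joined G path ux
... | inj₂ refl | inj₁ refl = Dist≤2-sym (isolated G w) (2-path-ends-joined G path ux)
... | inj₂ refl | inj₂ refl = ⊥-elim (s≢t refl)

near-middle : (G : Graph) {u v w x : Vertex G} → Is2Path G u v w x → Adj G u x →
  ∀ t → t ≢ w → Dist≤2 G w t → t ≡ v ⊎ t ≡ x ⊎ Adj (isolated G w) x t
near-middle G (_ , _ , _ , _ , v≢x , _ , _ , vw , wx , _ , dw) _ t _ (inj₁ wt) =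
  map₂ inj₁ (neighbours-of-degree-2 G dw (Adj-sym G vw) wx v≢x wt)
near-middle G (_ , u≢w , _ , _ , v≢x , w≢x , uv , vw , wx , dv , dw) ux t t≢w (inj₂ (m , wm , mt))
  with neighbours-of-degree-2 G dw (Adj-sym G vw) wx v≢x wm
... | inj₂ refl = inj₂ (inj₂ (Adj⇒Adj-isolated G _ (w≢x ∘ sym) t≢w mt))
... | inj₁ refl with neighbours-of-degree-2 G dv (Adj-sym G uv) vw u≢w mt
...   | inj₁ refl = inj₂ (inj₂ (Adj⇒Adj-isolated G _ (w≢x ∘ sym) u≢w (Adj-sym G ux)))
...   | inj₂ t≡w  = ⊥-elim (t≢w t≡w)

extend-colouring : (G : Graph) {k : ℕ} {u v w x : Vertex G} → Is2Path G u v w x → Adj G u x →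
  suc (deg G x) < k → Has2DistColoring (isolated G w) k → Has2DistColoring G k
extend-colouring G {k} {v = v} {w} {x} path@(_ , _ , _ , _ , _ , w≢x , _ , _ , wx , _) ux few (c , proper) =
  recolour G w c col
    (λ s t s≢t s≢w t≢w d → proper s t s≢t (Dist≤2-isolated G path ux s t s≢t s≢w t≢w d))
    (λ t t≢w d col≡ct → col∉ (subst (_∈ forbidden) (sym col≡ct) (forbidden-∈ (near-middle G path ux t t≢w d))))
  where
  forbidden : List (Fin k)
  forbidden = c v ∷ c x ∷ colours c (adj (isolated G w) x)

  short : length forbidden < k
  short rewrite length-colours c (adj (isolated G w) x) =
    ≤-<-trans (s≤s (deg-isolated-< G w (Adj-sym G wx))) few

  col : Fin k
  col = proj₁ (short-list-misses forbidden short)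
  col∉ : col ∉ forbidden
  col∉ = proj₂ (short-list-misses forbidden short)

  forbidden-∈ : ∀ {t} → t ≡ v ⊎ t ≡ x ⊎ Adj (isolated G w) x t → c t ∈ forbidden
  forbidden-∈ (inj₁ refl)        = here refl
  forbidden-∈ (inj₂ (inj₁ refl)) = there (here refl)
  forbidden-∈ (inj₂ (inj₂ xt))   = there (there (∈-colours c _ xt))

lemma9 : (G : Graph) → MinimalCounterexample G →
         (u v w x : Vertex G) → Is2Path G u v w x →
         deg G u ≡ 7 → deg G x ≤ 6 → ¬ Adj G u x
lemma9 G (mad , (Δ≤7 , _) , uncolourable , minimal) u v w x path@(_ , _ , _ , _ , _ , _ , _ , vw , _) _ dx ux =
  uncolourable (extend-colouring G path ux (s≤s (s≤s dx)) colouring)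
  where
  colouring : Has2DistColoring (isolated G w) 8
  colouring = minimal (isolated G w) (isolated-mad G w mad) (isolated-maxdeg G w Δ≤7)
                (+-monoʳ-< (n G) (nEdges-isolated-< G w (Adj-sym G vw)))
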